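{- Let $G=(X,Y,E)$ be a bipartite graph with fixed bipartition, let $w\in Y$, and let $G'=G\setminus w$ (with bipartition $(X,Y\setminus\{w\})$). Then $\mathfrak{M}(G)\cap X\supseteq\mathfrak{M}(G')\cap X$ and $\mathfrak{M}(G)\cap(Y\setminus\{w\})\subseteq\mathfrak{M}(G')\cap Y$.
   Context: For a bipartite graph $G$, $\mathfrak{M}(G)$ (the matching selector) is the set of all vertices of $G$ that are matched in every maximum matching of $G$. -}

module Defs where

open import Data.Nat using (ℕ; _≤_)
open import Data.Fin using (Fin; punchIn)
open import Data.Bool using (Bool; true; false; T)
open import Data.Product using (Σ; ∃; _×_)
open import Relation.Binary.PropositionalEquality using (_≡_)
open import Data.Vec.Functional using (foldr)
open import Data.Nat using (_+_)
open import Data.Bool using (if_then_else_)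

-- A bipartite graph with fixed bipartition (X, Y) where X = Fin m, Y = Fin n.
-- E x y = true  iff  {x, y} is an edge.
BipGraph : ℕ → ℕ → Set
BipGraph m n = Fin m → Fin n → Bool

EdgeSet : ℕ → ℕ → Set
EdgeSet m n = Fin m → Fin n → Bool

record IsMatching {m n : ℕ} (G : BipGraph m n) (M : EdgeSet m n) : Set where
  field
    sub  : ∀ x y → T (M x y) → T (G x y)
    uniX : ∀ x y y' → T (M x y) → T (M x y') → y ≡ y'
    uniY : ∀ x x' y → T (M x y) → T (M x' y) → x ≡ x'

count : {k : ℕ} → (Fin k → Bool) → ℕ
count {k} f = foldr (λ b s → (if b then 1 else 0) + s) 0 f

size : {m n : ℕ} → EdgeSet m n → ℕ
size M = foldr _+_ 0 (λ x → count (M x))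

IsMaxMatching : {m n : ℕ} → BipGraph m n → EdgeSet m n → Set
IsMaxMatching G M = IsMatching G M × (∀ M' → IsMatching G M' → size M' ≤ size M)

CoveredX : {m n : ℕ} → EdgeSet m n → Fin m → Set
CoveredX M x = ∃ λ y → T (M x y)

CoveredY : {m n : ℕ} → EdgeSet m n → Fin n → Set
CoveredY M y = ∃ λ x → T (M x y)

-- The matching selector 𝔐(G), split into its X-part and Y-part:
-- vertices matched in every maximum matching of G.
SelX : {m n : ℕ} → BipGraph m n → Fin m → Set
SelX G x = ∀ M → IsMaxMatching G M → CoveredX M x

SelY : {m n : ℕ} → BipGraph m n → Fin n → Set
SelY G y = ∀ M → IsMaxMatching G M → CoveredY M y

-- G \ w for w ∈ Y: the vertex w removed; the remaining Y-vertices
-- Y \ {w} are indexed by Fin k via punchIn w.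
deleteY : {m k : ℕ} → BipGraph m (ℕ.suc k) → Fin (ℕ.suc k) → BipGraph m k
deleteY G w x y = G x (punchIn w y)

module Submission where

-- Everything rests on an alternating-path exchange lemma (`exchange`):
-- if a matching A covers v ∈ X and a matching B does not, then either B
-- can be augmented by one edge, covering in X only its old vertices and v,
-- or A can be rerouted into an equally large matching that misses v and
-- covers in Y only vertices A already covered.  It is proved by following
-- the alternating path v –A– u –B– v₂ –A– …, by induction on |A|.
--
-- For the X-part, compare a maximum matching M of G missing x with a
-- maximum matching of G \ w viewed in G: augmenting M is impossible, and
-- rerouting yields a maximum matching of G \ w missing x.  The Y-part is
-- the same argument with the roles of X and Y exchanged (by transposing)
-- and of G and G \ w exchanged.  Maximum matchings exist only in the
-- double-negated sense (`maximum-matching-¬¬exists`), which suffices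
-- because being covered is decidable.

open import Defs
open import Data.Nat using (ℕ; zero; suc; _+_; _≤_; _≤?_; z≤n)
open import Data.Nat.Properties
  using (+-0-commutativeMonoid; +-mono-≤; ≤-refl; ≤-trans; ≤-reflexive; ≰⇒>; +-suc; +-monoˡ-≤;
         +-comm; +-identityʳ; m≤n+m; 0≢1+n; 1+n≰n; suc-injective)
open import Data.Nat.Tactic.RingSolver using (solve-∀)
open import Data.Fin using (Fin; punchIn; punchOut; _≟_) renaming (zero to fzero; suc to fsuc)
open import Data.Fin.Properties using (any?; punchInᵢ≢i; punchIn-injective; punchIn-punchOut)
open import Data.Bool using (Bool; true; false; T; if_then_else_)
open import Data.Unit using (tt)
open import Data.Empty using (⊥; ⊥-elim)
open import Data.Product using (_×_; _,_; proj₁; proj₂; ∃)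
open import Data.Sum using (_⊎_; inj₁; inj₂)
import Data.Sum as Sum
open import Data.Vec.Functional using (removeAt)
open import Relation.Nullary using (¬_; Dec; yes; no)
open import Relation.Nullary.Decidable using (T?)
open import Relation.Binary.PropositionalEquality
  using (_≡_; _≢_; refl; sym; trans; cong; cong₂; subst; subst₂; module ≡-Reasoning)

open import Algebra.Properties.CommutativeMonoid.Sum +-0-commutativeMonoid
  using (sum; sum-cong-≗; sum-remove; ∑-comm)

private
  variable
    m n k : ℕ

indicator : Bool → ℕ
indicator b = if b then 1 else 0

-- `count` is the sum of the indicators, so the library's lemmas on finite
-- sums apply to `size`.
count≡sum : (f : Fin n → Bool) → count f ≡ sum (λ i → indicator (f i))
count≡sum {zero}  f = refl
count≡sum {suc n} f = cong (indicator (f fzero) +_) (count≡sum (λ i → f (fsuc i)))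

rowSize : EdgeSet m n → Fin m → ℕ
rowSize M x = sum (λ y → indicator (M x y))

size≡sum-rowSize : (M : EdgeSet m n) → size M ≡ sum (rowSize M)
size≡sum-rowSize M = sum-cong-≗ (λ x → count≡sum (M x))

size-cong : {M N : EdgeSet m n} → (∀ x y → M x y ≡ N x y) → size M ≡ size N
size-cong {M = M} {N} M≗N = begin
  size M             ≡⟨ size≡sum-rowSize M ⟩
  sum (rowSize M)    ≡⟨ sum-cong-≗ (λ x → sum-cong-≗ (λ y → cong indicator (M≗N x y))) ⟩
  sum (rowSize N)    ≡⟨ size≡sum-rowSize N ⟨
  size N             ∎
  where open ≡-Reasoning

sum-mono : {f g : Fin n → ℕ} → (∀ i → f i ≤ g i) → sum f ≤ sum g
sum-mono {zero}  f≤g = ≤-refl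
sum-mono {suc n} f≤g = +-mono-≤ (f≤g fzero) (sum-mono (λ i → f≤g (fsuc i)))

_⊆_ : EdgeSet m n → EdgeSet m n → Set
M ⊆ N = ∀ {x y} → T (M x y) → T (N x y)

indicator-mono : {a b : Bool} → (T a → T b) → indicator a ≤ indicator b
indicator-mono {false}         a⇒b = z≤n
indicator-mono {true}  {false} a⇒b = ⊥-elim (a⇒b tt)
indicator-mono {true}  {true}  a⇒b = ≤-refl

size-mono : {M N : EdgeSet m n} → M ⊆ N → size M ≤ size N
size-mono {M = M} {N} M⊆N =
  subst₂ _≤_ (sym (size≡sum-rowSize M)) (sym (size≡sum-rowSize N))
    (sum-mono (λ x → sum-mono (λ y → indicator-mono (M⊆N {x} {y}))))

transpose : EdgeSet m n → EdgeSet n m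
transpose M y x = M x y

size-transpose : (M : EdgeSet m n) → size (transpose M) ≡ size M
size-transpose M = begin
  size (transpose M)                                ≡⟨ size≡sum-rowSize (transpose M) ⟩
  sum (λ y → sum (λ x → indicator (M x y)))         ≡⟨ ∑-comm (λ x y → indicator (M x y)) ⟨
  sum (rowSize M)                                   ≡⟨ size≡sum-rowSize M ⟨
  size M                                            ∎
  where open ≡-Reasoning

set : EdgeSet m n → Fin m → Fin n → Bool → EdgeSet m n
set M a b v x y with x ≟ a | y ≟ b
... | yes _ | yes _ = v
... | _     | _     = M x y

insertEdge removeEdge : EdgeSet m n → Fin m → Fin n → EdgeSet m n
insertEdge M a b = set M a b true
removeEdge M a b = set M a b false

set-at : ∀ (M : EdgeSet m n) a b v → set M a b v a b ≡ v
set-at M a b v with a ≟ a | b ≟ b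
... | yes _  | yes _  = refl
... | no a≢a | _      = ⊥-elim (a≢a refl)
... | yes _  | no b≢b = ⊥-elim (b≢b refl)

set-off : ∀ (M : EdgeSet m n) a b v x y → ¬ (x ≡ a × y ≡ b) → set M a b v x y ≡ M x y
set-off M a b v x y off with x ≟ a | y ≟ b
... | yes x≡a | yes y≡b = ⊥-elim (off (x≡a , y≡b))
... | yes _   | no _    = refl
... | no _    | yes _   = refl
... | no _    | no _    = refl

T-insert : ∀ (M : EdgeSet m n) a b x y → T (insertEdge M a b x y) → (x ≡ a × y ≡ b) ⊎ T (M x y)
T-insert M a b x y t with x ≟ a | y ≟ b
... | yes x≡a | yes y≡b = inj₁ (x≡a , y≡b)
... | yes _   | no _    = inj₂ t
... | no _    | yes _   = inj₂ t
... | no _    | no _    = inj₂ t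

T-remove : ∀ (M : EdgeSet m n) a b x y → T (removeEdge M a b x y) → T (M x y) × ¬ (x ≡ a × y ≡ b)
T-remove M a b x y t with x ≟ a | y ≟ b
... | yes _ | yes _   = ⊥-elim t
... | yes _ | no y≢b  = t , λ (_ , y≡b) → y≢b y≡b
... | no x≢a | yes _  = t , λ (x≡a , _) → x≢a x≡a
... | no x≢a | no _   = t , λ (x≡a , _) → x≢a x≡a

removeEdge⊆ : ∀ (M : EdgeSet m n) a b → removeEdge M a b ⊆ M
removeEdge⊆ M a b {x} {y} t = proj₁ (T-remove M a b x y t)

size-split : ∀ (M : EdgeSet (suc m) (suc n)) a b →
  size M ≡ (indicator (M a b) + sum (removeAt (λ y → indicator (M a y)) b))
           + sum (removeAt (rowSize M) a)
size-split M a b = begin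
  size M                                                    ≡⟨ size≡sum-rowSize M ⟩
  sum (rowSize M)                                           ≡⟨ sum-remove {i = a} (rowSize M) ⟩
  rowSize M a + sum (removeAt (rowSize M) a)                ≡⟨ cong (_+ sum (removeAt (rowSize M) a)) (sum-remove {i = b} (λ y → indicator (M a y))) ⟩
  (indicator (M a b) + sum (removeAt (λ y → indicator (M a y)) b))
    + sum (removeAt (rowSize M) a)                          ∎
  where open ≡-Reasoning

size-set : ∀ (M : EdgeSet m n) a b v → size (set M a b v) + indicator (M a b) ≡ size M + indicator v
size-set {zero}          M () b v
size-set {suc m} {zero}  M a () v
size-set {suc m} {suc n} M a b v = begin
  size S + indicator (M a b)
    ≡⟨ cong (_+ indicator (M a b)) (size-split S a b) ⟩
  ((indicator (S a b) + sum (removeAt (λ y → indicator (S a y)) b)) + sum (removeAt (rowSize S) a))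
    + indicator (M a b)
    ≡⟨ cong₂ (λ e r → (e + r) + indicator (M a b))
             (cong₂ (λ p q → indicator p + q) (set-at M a b v) rest-of-row) other-rows ⟩
  ((indicator v + sum (removeAt (λ y → indicator (M a y)) b)) + sum (removeAt (rowSize M) a))
    + indicator (M a b)
    ≡⟨ exchange-ends (indicator v) _ _ (indicator (M a b)) ⟩
  ((indicator (M a b) + sum (removeAt (λ y → indicator (M a y)) b)) + sum (removeAt (rowSize M) a))
    + indicator v
    ≡⟨ cong (_+ indicator v) (size-split M a b) ⟨
  size M + indicator v ∎
  where
  open ≡-Reasoning
  S : EdgeSet (suc m) (suc n)
  S = set M a b v
  exchange-ends : ∀ p q r s → ((p + q) + r) + s ≡ ((s + q) + r) + p
  exchange-ends = solve-∀
  rest-of-row : sum (removeAt (λ y → indicator (S a y)) b) ≡ sum (removeAt (λ y → indicator (M a y)) b)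
  rest-of-row = sum-cong-≗ λ j →
    cong indicator (set-off M a b v a (punchIn b j) (λ (_ , e) → punchInᵢ≢i b j e))
  other-rows : sum (removeAt (rowSize S) a) ≡ sum (removeAt (rowSize M) a)
  other-rows = sum-cong-≗ λ i → sum-cong-≗ λ y →
    cong indicator (set-off M a b v (punchIn a i) y (λ (e , _) → punchInᵢ≢i a i e))

size-insertEdge : ∀ (M : EdgeSet m n) a b → ¬ T (M a b) → size (insertEdge M a b) ≡ suc (size M)
size-insertEdge M a b ab∉M with M a b | size-set M a b true
... | true  | _ = ⊥-elim (ab∉M tt)
... | false | e = trans (+-comm 0 _) (trans e (+-comm (size M) 1))

size-removeEdge : ∀ (M : EdgeSet m n) a b → T (M a b) → size M ≡ suc (size (removeEdge M a b))
size-removeEdge M a b ab∈M with M a b | size-set M a b false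
... | false | _ = ⊥-elim ab∈M
... | true  | e = trans (+-comm 0 _) (trans (sym e) (+-comm _ 1))

¬¬-maximum : {A : Set} (P : A → Set) (f : A → ℕ) (bound : ℕ) → (∀ a → P a → f a ≤ bound) →
  ∀ a₀ → P a₀ → ¬ ¬ (∃ λ a → P a × (∀ b → P b → f b ≤ f a))
¬¬-maximum P f bound bounded a₀ Pa₀ = climb bound a₀ Pa₀ (m≤n+m bound (f a₀))
  where
  -- `d` bounds the distance from f a to the bound; a maximiser is found
  -- by climbing to larger values, which can happen at most `d` times.
  climb : ∀ d a → P a → bound ≤ f a + d → ¬ ¬ (∃ λ a → P a × (∀ b → P b → f b ≤ f a))
  climb zero    a Pa close no-max = no-max (a , Pa , λ b Pb →
    ≤-trans (bounded b Pb) (subst (bound ≤_) (+-identityʳ (f a)) close))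
  climb (suc d) a Pa close no-max = no-max (a , Pa , at-most-a)
    where
    at-most-a : ∀ b → P b → f b ≤ f a
    at-most-a b Pb with f b ≤? f a
    ... | yes fb≤fa = fb≤fa
    ... | no  fb≰fa = ⊥-elim (climb d b Pb b-closer no-max)
      where
      b-closer : bound ≤ f b + d
      b-closer = ≤-trans close (subst (_≤ f b + d) (sym (+-suc (f a) d)) (+-monoˡ-≤ d (≰⇒> fb≰fa)))

module _ (G : BipGraph m n) where
  open IsMatching

  emptyMatching : IsMatching G (λ _ _ → false)
  emptyMatching = record { sub = λ _ _ () ; uniX = λ _ _ _ () ; uniY = λ _ _ _ () }

  maximum-matching-¬¬exists : ¬ ¬ (∃ λ M → IsMaxMatching G M)
  maximum-matching-¬¬exists =
    ¬¬-maximum (IsMatching G) size (size {m} {n} (λ _ _ → true)) (λ M _ → size-mono {m} {n} {M} (λ _ → tt))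
      (λ _ _ → false) emptyMatching

  maximum-by-size : ∀ {M N} → IsMaxMatching G M → IsMatching G N → size M ≤ size N → IsMaxMatching G N
  maximum-by-size (_ , M-max) mN M≤N = mN , λ K mK → ≤-trans (M-max K mK) M≤N

  no-larger-matching : ∀ {M N} → IsMaxMatching G M → IsMatching G N → size N ≡ suc (size M) → ⊥
  no-larger-matching (_ , M-max) mN N≡1+M = 1+n≰n (subst (_≤ _) N≡1+M (M-max _ mN))

  removeEdge-matching : ∀ {M} a b → IsMatching G M → IsMatching G (removeEdge M a b)
  removeEdge-matching {M} a b mM = record
    { sub  = λ x y t → sub mM x y (⊆M t)
    ; uniX = λ x y y' t t' → uniX mM x y y' (⊆M t) (⊆M t')
    ; uniY = λ x x' y t t' → uniY mM x x' y (⊆M t) (⊆M t') }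
    where
    ⊆M : removeEdge M a b ⊆ M
    ⊆M = removeEdge⊆ M a b

  insertEdge-matching : ∀ {M} a b → IsMatching G M → T (G a b) →
    ¬ CoveredX M a → ¬ CoveredY M b → IsMatching G (insertEdge M a b)
  insertEdge-matching {M} a b mM ab∈G a∉M b∉M = record { sub = sb ; uniX = ux ; uniY = uy }
    where
    sb : ∀ x y → T (insertEdge M a b x y) → T (G x y)
    sb x y t with T-insert M a b x y t
    ... | inj₁ (refl , refl) = ab∈G
    ... | inj₂ t' = sub mM x y t'
    ux : ∀ x y y' → T (insertEdge M a b x y) → T (insertEdge M a b x y') → y ≡ y'
    ux x y y' t t' with T-insert M a b x y t | T-insert M a b x y' t'
    ... | inj₁ (refl , refl) | inj₁ (_ , refl) = refl
    ... | inj₁ (refl , refl) | inj₂ s          = ⊥-elim (a∉M (y' , s))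
    ... | inj₂ s             | inj₁ (refl , _) = ⊥-elim (a∉M (y , s))
    ... | inj₂ s             | inj₂ s'         = uniX mM x y y' s s'
    uy : ∀ x x' y → T (insertEdge M a b x y) → T (insertEdge M a b x' y) → x ≡ x'
    uy x x' y t t' with T-insert M a b x y t | T-insert M a b x' y t'
    ... | inj₁ (refl , refl) | inj₁ (refl , _) = refl
    ... | inj₁ (refl , refl) | inj₂ s          = ⊥-elim (b∉M (x' , s))
    ... | inj₂ s             | inj₁ (_ , refl) = ⊥-elim (b∉M (x , s))
    ... | inj₂ s             | inj₂ s'         = uniY mM x x' y s s'

  removeEdge-freesX : ∀ {M a b} → IsMatching G M → T (M a b) → ¬ CoveredX (removeEdge M a b) a
  removeEdge-freesX {M} {a} {b} mM ab∈M (y , t) with T-remove M a b a y t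
  ... | ay∈M , ay≢ab = ay≢ab (refl , uniX mM a y b ay∈M ab∈M)

  removeEdge-freesY : ∀ {M a b} → IsMatching G M → T (M a b) → ¬ CoveredY (removeEdge M a b) b
  removeEdge-freesY {M} {a} {b} mM ab∈M (x , t) with T-remove M a b x b t
  ... | xb∈M , xb≢ab = xb≢ab (uniY mM x a b xb∈M ab∈M , refl)

  transpose-matching : ∀ {M} → IsMatching G M → IsMatching (transpose G) (transpose M)
  transpose-matching mM = record
    { sub  = λ y x t → sub mM x y t
    ; uniX = λ y x x' t t' → uniY mM x x' y t t'
    ; uniY = λ y y' x t t' → uniX mM x y y' t t' }

coveredX-⊆ : {M N : EdgeSet m n} → M ⊆ N → ∀ {x} → CoveredX M x → CoveredX N x
coveredX-⊆ M⊆N (y , t) = y , M⊆N t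

coveredY-⊆ : {M N : EdgeSet m n} → M ⊆ N → ∀ {y} → CoveredY M y → CoveredY N y
coveredY-⊆ M⊆N (x , t) = x , M⊆N t

coveredX-insert : ∀ (M : EdgeSet m n) a b x → CoveredX (insertEdge M a b) x → x ≡ a ⊎ CoveredX M x
coveredX-insert M a b x (y , t) = Sum.map proj₁ (y ,_) (T-insert M a b x y t)

coveredY-insert : ∀ (M : EdgeSet m n) a b y → CoveredY (insertEdge M a b) y → y ≡ b ⊎ CoveredY M y
coveredY-insert M a b y (x , t) = Sum.map proj₂ (x ,_) (T-insert M a b x y t)

coveredX? : ∀ (M : EdgeSet m n) x → Dec (CoveredX M x)
coveredX? M x = any? (λ y → T? (M x y))

coveredY? : ∀ (M : EdgeSet m n) y → Dec (CoveredY M y)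
coveredY? M y = any? (λ x → T? (M x y))

module Exchange (G : BipGraph m n) where
  open IsMatching

  record Augmentation (A B : EdgeSet m n) (v : Fin m) : Set where
    field
      B'       : EdgeSet m n
      matching : IsMatching G B'
      larger   : size B' ≡ suc (size B)
      coverX   : ∀ x → CoveredX B' x → CoveredX B x ⊎ x ≡ v
      coverY   : ∀ y → CoveredY B' y → CoveredY B y ⊎ CoveredY A y

  record Release (A B : EdgeSet m n) (v : Fin m) : Set where
    field
      A'        : EdgeSet m n
      matching  : IsMatching G A'
      same-size : size A' ≡ size A
      frees     : ¬ CoveredX A' v
      coverY    : ∀ y → CoveredY A' y → CoveredY A y
      coverX    : ∀ x → CoveredX A' x → CoveredX A x ⊎ CoveredX B x

  trivial-release : ∀ {A B v} → IsMatching G A → ¬ CoveredX A v → Release A B v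
  trivial-release {A} mA v∉A = record
    { A' = A ; matching = mA ; same-size = refl ; frees = v∉A
    ; coverY = λ _ c → c ; coverX = λ _ → inj₁ }

  augment-directly : ∀ {A B v u} → IsMatching G A → IsMatching G B → T (A v u) →
    ¬ CoveredX B v → ¬ CoveredY B u → Augmentation A B v
  augment-directly {B = B} {v} {u} mA mB vu∈A v∉B u∉B = record
    { B'       = insertEdge B v u
    ; matching = insertEdge-matching G v u mB (sub mA v u vu∈A) v∉B u∉B
    ; larger   = size-insertEdge B v u (λ t → v∉B (u , t))
    ; coverX   = λ x c → Sum.swap (coveredX-insert B v u x c)
    ; coverY   = λ y c → Sum.[ (λ { refl → inj₂ (v , vu∈A) }) , inj₁ ] (coveredY-insert B v u y c) }

  -- One step along the alternating path v –A– u –B– v₂: with A₁ = A - vu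
  -- and B₁ = B - v₂u, an augmentation or release for (A₁, B₁, v₂) extends
  -- to one for (A, B, v).
  module Step {A B : EdgeSet m n} {v v₂ : Fin m} {u : Fin n}
              (mA : IsMatching G A) (mB : IsMatching G B)
              (vu∈A : T (A v u)) (v₂u∈B : T (B v₂ u)) (v∉B : ¬ CoveredX B v) where

    A₁ B₁ : EdgeSet m n
    A₁ = removeEdge A v u
    B₁ = removeEdge B v₂ u

    A₁⇒A-X : ∀ {x} → CoveredX A₁ x → CoveredX A x
    A₁⇒A-X = coveredX-⊆ {M = A₁} {A} (removeEdge⊆ A v u)

    A₁⇒A-Y : ∀ {y} → CoveredY A₁ y → CoveredY A y
    A₁⇒A-Y = coveredY-⊆ {M = A₁} {A} (removeEdge⊆ A v u)

    B₁⇒B-X : ∀ {x} → CoveredX B₁ x → CoveredX B x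
    B₁⇒B-X = coveredX-⊆ {M = B₁} {B} (removeEdge⊆ B v₂ u)

    B₁⇒B-Y : ∀ {y} → CoveredY B₁ y → CoveredY B y
    B₁⇒B-Y = coveredY-⊆ {M = B₁} {B} (removeEdge⊆ B v₂ u)

    v≢v₂ : v ≢ v₂
    v≢v₂ refl = v∉B (u , v₂u∈B)

    extend-augmentation : Augmentation A₁ B₁ v₂ → Augmentation A B v
    extend-augmentation r = record
      { B'       = insertEdge R.B' v u
      ; matching = insertEdge-matching G v u R.matching (sub mA v u vu∈A) v∉B' u∉B'
      ; larger   = trans (size-insertEdge R.B' v u (λ t → v∉B' (u , t)))
                         (cong suc (trans R.larger (sym (size-removeEdge B v₂ u v₂u∈B))))
      ; coverX   = cover-X
      ; coverY   = cover-Y }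
      where
      module R = Augmentation r
      v∉B' : ¬ CoveredX R.B' v
      v∉B' c with R.coverX v c
      ... | inj₁ v∈B₁ = v∉B (B₁⇒B-X v∈B₁)
      ... | inj₂ v≡v₂ = v≢v₂ v≡v₂
      u∉B' : ¬ CoveredY R.B' u
      u∉B' c with R.coverY u c
      ... | inj₁ u∈B₁ = removeEdge-freesY G mB v₂u∈B u∈B₁
      ... | inj₂ u∈A₁ = removeEdge-freesY G mA vu∈A u∈A₁
      cover-X : ∀ x → CoveredX (insertEdge R.B' v u) x → CoveredX B x ⊎ x ≡ v
      cover-X x c with coveredX-insert R.B' v u x c
      ... | inj₁ x≡v = inj₂ x≡v
      ... | inj₂ x∈B' with R.coverX x x∈B'
      ...   | inj₁ x∈B₁ = inj₁ (B₁⇒B-X x∈B₁)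
      ...   | inj₂ refl = inj₁ (u , v₂u∈B)
      cover-Y : ∀ y → CoveredY (insertEdge R.B' v u) y → CoveredY B y ⊎ CoveredY A y
      cover-Y y c with coveredY-insert R.B' v u y c
      ... | inj₁ refl = inj₂ (v , vu∈A)
      ... | inj₂ y∈B' = Sum.map B₁⇒B-Y A₁⇒A-Y (R.coverY y y∈B')

    extend-release : Release A₁ B₁ v₂ → Release A B v
    extend-release r = record
      { A'        = insertEdge R.A' v₂ u
      ; matching  = insertEdge-matching G v₂ u R.matching (sub mB v₂ u v₂u∈B) R.frees u∉A'
      ; same-size = trans (size-insertEdge R.A' v₂ u (λ t → R.frees (u , t)))
                          (trans (cong suc R.same-size) (sym (size-removeEdge A v u vu∈A)))
      ; frees     = v∉A'
      ; coverY    = cover-Y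
      ; coverX    = cover-X }
      where
      module R = Release r
      u∉A' : ¬ CoveredY R.A' u
      u∉A' c = removeEdge-freesY G mA vu∈A (R.coverY u c)
      v∉A' : ¬ CoveredX (insertEdge R.A' v₂ u) v
      v∉A' c with coveredX-insert R.A' v₂ u v c
      ... | inj₁ v≡v₂ = v≢v₂ v≡v₂
      ... | inj₂ v∈A' with R.coverX v v∈A'
      ...   | inj₁ v∈A₁ = removeEdge-freesX G mA vu∈A v∈A₁
      ...   | inj₂ v∈B₁ = v∉B (B₁⇒B-X v∈B₁)
      cover-Y : ∀ y → CoveredY (insertEdge R.A' v₂ u) y → CoveredY A y
      cover-Y y c with coveredY-insert R.A' v₂ u y c
      ... | inj₁ refl = v , vu∈A
      ... | inj₂ y∈A' = A₁⇒A-Y (R.coverY y y∈A')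
      cover-X : ∀ x → CoveredX (insertEdge R.A' v₂ u) x → CoveredX A x ⊎ CoveredX B x
      cover-X x c with coveredX-insert R.A' v₂ u x c
      ... | inj₁ refl = inj₂ (u , v₂u∈B)
      ... | inj₂ x∈A' = Sum.map A₁⇒A-X B₁⇒B-X (R.coverX x x∈A')

  exchange : ∀ N {A B v} → size A ≡ N → IsMatching G A → IsMatching G B →
    CoveredX A v → ¬ CoveredX B v → Augmentation A B v ⊎ Release A B v
  exchange zero {A} {v = v} |A|≡0 _ _ (u , vu∈A) _ =
    ⊥-elim (0≢1+n (trans (sym |A|≡0) (size-removeEdge A v u vu∈A)))
  exchange (suc N) {A} {B} {v} |A|≡1+N mA mB (u , vu∈A) v∉B with coveredY? B u
  ... | no u∉B = inj₁ (augment-directly mA mB vu∈A v∉B u∉B)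
  ... | yes (v₂ , v₂u∈B) =
    Sum.map extend-augmentation extend-release along-the-path
    where
    open Step mA mB vu∈A v₂u∈B v∉B
    along-the-path : Augmentation A₁ B₁ v₂ ⊎ Release A₁ B₁ v₂
    along-the-path with coveredX? A₁ v₂
    ... | no v₂∉A₁ = inj₂ (trivial-release (removeEdge-matching G v u mA) v₂∉A₁)
    ... | yes v₂∈A₁ =
      exchange N (suc-injective (trans (sym (size-removeEdge A v u vu∈A)) |A|≡1+N))
        (removeEdge-matching G v u mA) (removeEdge-matching G v₂ u mB)
        v₂∈A₁ (removeEdge-freesX G mB v₂u∈B)

extendY : Fin (suc k) → EdgeSet m k → EdgeSet m (suc k)
extendY w M x y with w ≟ y
... | yes _   = false
... | no w≢y  = M x (punchOut w≢y)

extendY-avoids : ∀ w (M : EdgeSet m k) x → ¬ T (extendY w M x w)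
extendY-avoids w M x t with w ≟ w
... | no w≢w = w≢w refl

extendY-punchIn : ∀ w (M : EdgeSet m k) x y → extendY w M x (punchIn w y) ≡ M x y
extendY-punchIn w M x y with w ≟ punchIn w y
... | yes w≡wʸ = ⊥-elim (punchInᵢ≢i w y (sym w≡wʸ))
... | no w≢wʸ  = cong (M x) (punchIn-injective w _ _ (punchIn-punchOut w≢wʸ))

extendY-edge : ∀ w (M : EdgeSet m k) x y → T (extendY w M x y) →
  ∃ λ y' → y ≡ punchIn w y' × T (M x y')
extendY-edge w M x y t with w ≟ y
... | no w≢y = punchOut w≢y , sym (punchIn-punchOut w≢y) , t

size-deleteY : ∀ (N : EdgeSet m (suc k)) w → (∀ x → ¬ T (N x w)) → size (deleteY N w) ≡ size N
size-deleteY N w w∉N = begin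
  size (deleteY N w)                         ≡⟨ size≡sum-rowSize (deleteY N w) ⟩
  sum (rowSize (deleteY N w))                ≡⟨ sum-cong-≗ (λ x → sym (row x)) ⟩
  sum (rowSize N)                            ≡⟨ size≡sum-rowSize N ⟨
  size N                                     ∎
  where
  open ≡-Reasoning
  row : ∀ x → rowSize N x ≡ rowSize (deleteY N w) x
  row x with N x w in Nxw | sum-remove {i = w} (λ y → indicator (N x y))
  ... | false | split = split
  ... | true  | _     = ⊥-elim (w∉N x (subst T (sym Nxw) tt))

size-extendY : ∀ w (M : EdgeSet m k) → size (extendY w M) ≡ size M
size-extendY w M = trans (sym (size-deleteY (extendY w M) w (extendY-avoids w M)))
                         (size-cong (extendY-punchIn w M))

module _ {G : BipGraph m (suc k)} (w : Fin (suc k)) where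
  open IsMatching

  deleteY-matching : ∀ {N} → IsMatching G N → IsMatching (deleteY G w) (deleteY N w)
  deleteY-matching mN = record
    { sub  = λ x y t → sub mN x (punchIn w y) t
    ; uniX = λ x y y' t t' → punchIn-injective w y y' (uniX mN x _ _ t t')
    ; uniY = λ x x' y t t' → uniY mN x x' _ t t' }

  extendY-matching : ∀ {M} → IsMatching (deleteY G w) M → IsMatching G (extendY w M)
  extendY-matching {M} mM = record { sub = sb ; uniX = ux ; uniY = uy }
    where
    sb : ∀ x y → T (extendY w M x y) → T (G x y)
    sb x y t with extendY-edge w M x y t
    ... | y' , refl , s = sub mM x y' s
    ux : ∀ x y y' → T (extendY w M x y) → T (extendY w M x y') → y ≡ y'
    ux x y y' t t' with extendY-edge w M x y t | extendY-edge w M x y' t'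
    ... | a , refl , s | b , refl , s' = cong (punchIn w) (uniX mM x a b s s')
    uy : ∀ x x' y → T (extendY w M x y) → T (extendY w M x' y) → x ≡ x'
    uy x x' y t t' with extendY-edge w M x y t | extendY-edge w M x' y t'
    ... | a , refl , s | b , wᵃ≡wᵇ , s' =
      uniY mM x x' a s (subst (λ z → T (M x' z)) (sym (punchIn-injective w a b wᵃ≡wᵇ)) s')

module _ (G : BipGraph m (suc k)) (w : Fin (suc k)) where

  selX-deleteY⇒selX : ∀ x → SelX (deleteY G w) x → SelX G x
  selX-deleteY⇒selX x sel M M-max with coveredX? M x
  ... | yes x∈M = x∈M
  ... | no  x∉M = ⊥-elim (maximum-matching-¬¬exists (deleteY G w) impossible)
    where
    open Exchange G
    -- A maximum matching M' of G \ w covers x; compare it, inside G, with M.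
    impossible : ∃ (IsMaxMatching (deleteY G w)) → ⊥
    impossible (M' , M'-max@(mM' , _)) with sel M' M'-max
    ... | y , xy∈M' = Sum.[ augmented , released ]
      (exchange _ refl (extendY-matching w mM') (proj₁ M-max) x∈M'ᵂ x∉M)
      where
      x∈M'ᵂ : CoveredX (extendY w M') x
      x∈M'ᵂ = punchIn w y , subst T (sym (extendY-punchIn w M' x y)) xy∈M'

      -- M is maximum, so it cannot be augmented.
      augmented : Augmentation (extendY w M') M x → ⊥
      augmented aug = no-larger-matching G M-max matching larger
        where open Augmentation aug

      -- The rerouted matching avoids w, so it is a maximum matching of
      -- G \ w missing x.
      released : Release (extendY w M') M x → ⊥
      released rel = frees (punchIn w (proj₁ x∈R) , proj₂ x∈R)
        where
        open Release rel
        A'-avoids-w : ∀ x → ¬ T (A' x w)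
        A'-avoids-w x t = extendY-avoids w M' _ (proj₂ (coverY w (x , t)))
        R : EdgeSet m k
        R = deleteY A' w
        R-max : IsMaxMatching (deleteY G w) R
        R-max = maximum-by-size (deleteY G w) M'-max (deleteY-matching w matching)
          (≤-reflexive (sym (trans (size-deleteY A' w A'-avoids-w) (trans same-size (size-extendY w M')))))
        x∈R : CoveredX R x
        x∈R = sel R R-max

  -- 𝔐(G) ∩ (Y \ {w}) ⊆ 𝔐(G \ w) ∩ Y: the same argument with X and Y
  -- exchanged by transposition, and with the roles of G and G \ w exchanged.
  selY⇒selY-deleteY : ∀ y → SelY G (punchIn w y) → SelY (deleteY G w) y
  selY⇒selY-deleteY y sel M' M'-max@(mM' , _) with coveredY? M' y
  ... | yes y∈M' = y∈M'
  ... | no  y∉M' = ⊥-elim (maximum-matching-¬¬exists G impossible)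
    where
    open Exchange (transpose G)
    M'ᵂ : EdgeSet m (suc k)
    M'ᵂ = extendY w M'

    wʸ∉M'ᵂ : ¬ CoveredY M'ᵂ (punchIn w y)
    wʸ∉M'ᵂ (x , t) = y∉M' (x , subst T (extendY-punchIn w M' x y) t)

    impossible : ∃ (IsMaxMatching G) → ⊥
    impossible (M , M-max@(mM , _)) = Sum.[ augmented , released ]
      (exchange _ refl (transpose-matching G mM) (transpose-matching G (extendY-matching w mM'))
                (sel M M-max) wʸ∉M'ᵂ)
      where
      -- The augmented matching avoids w, so it gives a matching of G \ w
      -- larger than the maximum matching M'.
      augmented : Augmentation (transpose M) (transpose M'ᵂ) (punchIn w y) → ⊥
      augmented aug = no-larger-matching (deleteY G w) M'-max
        (deleteY-matching w (transpose-matching (transpose G) matching)) R-larger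
        where
        open Augmentation aug
        B'-avoids-w : ∀ x → ¬ T (B' w x)
        B'-avoids-w x t with coverX w (x , t)
        ... | inj₁ (x' , t') = extendY-avoids w M' x' t'
        ... | inj₂ w≡wʸ     = punchInᵢ≢i w y (sym w≡wʸ)
        R-larger : size (deleteY (transpose B') w) ≡ suc (size M')
        R-larger = begin
          size (deleteY (transpose B') w)   ≡⟨ size-deleteY (transpose B') w B'-avoids-w ⟩
          size (transpose B')               ≡⟨ size-transpose B' ⟩
          size B'                           ≡⟨ larger ⟩
          suc (size (transpose M'ᵂ))        ≡⟨ cong suc (size-transpose M'ᵂ) ⟩
          suc (size M'ᵂ)                    ≡⟨ cong suc (size-extendY w M') ⟩
          suc (size M')                     ∎
          where open ≡-Reasoning

      -- The rerouted matching is a maximum matching of G missing w(y).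
      released : Release (transpose M) (transpose M'ᵂ) (punchIn w y) → ⊥
      released rel = frees (sel (transpose A') A'ᵀ-max)
        where
        open Release rel
        A'ᵀ-max : IsMaxMatching G (transpose A')
        A'ᵀ-max = maximum-by-size G M-max (transpose-matching (transpose G) matching)
          (≤-reflexive (sym (trans (size-transpose A') (trans same-size (size-transpose M)))))

lemma25 : {m k : ℕ} (G : BipGraph m (suc k)) (w : Fin (suc k)) →
    ((x : Fin m) → SelX (deleteY G w) x → SelX G x) ×
    ((y : Fin k) → SelY G (punchIn w y) → SelY (deleteY G w) y)
lemma25 G w = selX-deleteY⇒selX G w , selY⇒selY-deleteY G w
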